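{- Let $k,n \geq 1$ be integers, let $D$ be an $n$-vertex strongly $k$-arc-connected directed multigraph, and let $U \subsetneq V(D)$. Then there is a $k$-arc-escaper $(E_{\rm escape} , U , U_{\rm out})$ in $D$ such that $|E_{\rm escape}| \leq 4k|U|$ and $|U_{\rm out}| \leq 2k|U|$.
   Context: A directed multigraph is a pair $(V,E)$ with $E$ a multiset of elements of $(V\times V)\setminus\{(v,v)\}$; it is strongly $k$-arc-connected if deleting any at most $k-1$ edges leaves it strongly connected. A $k$-arc-escaper in $D$ is a triple $(E_{\rm escape},U,U_{\rm out})$ with $E_{\rm escape}\subseteq E(D)$ and $U,U_{\rm out}\subseteq V(D)$ such that (i) $U_{\rm out}\subseteq V(D)\setminus U$; (ii) for every $F\subseteq E(D)$ with $|F|\leq k-1$ and every $u\in U$, $D-F$ contains a path from $u$ to a vertex of $U_{\rm out}$ using only edges in $E_{\rm escape}$; (iii) for every such $F$ and every $v\in U$, $D-F$ contains a path from a vertex of $U_{\rm out}$ to $v$ using only edges in $E_{\rm escape}$. -}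

module Defs where

open import Data.Nat using (ℕ; suc; _≤_; _∸_; _*_)
open import Data.Fin using (Fin)
open import Data.Fin.Subset using (Subset; _∈_; _∉_; _⊆_; _⊂_; ∣_∣; ⊤)
open import Data.Product using (_×_; _,_; proj₁; proj₂; Σ; ∃; ∃-syntax)
open import Relation.Binary.PropositionalEquality using (_≡_)
open import Relation.Nullary using (¬_)

-- A directed multigraph on vertex set Fin n with m edges.
-- Edges are labelled by Fin m (so parallel edges are distinct labels);
-- each edge has a tail and head, and loops are forbidden.
record Multigraph (n : ℕ) : Set where
  field
    m        : ℕ
    tail     : Fin m → Fin n
    head     : Fin m → Fin n
    loopless : (e : Fin m) → ¬ (tail e ≡ head e)
open Multigraph public

EdgeSet : ∀ {n} → Multigraph n → Set
EdgeSet D = Subset (m D)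

-- Path u ⇝ v in D using only edges lying in A and not in F
-- (i.e. a path in D - F using only edges of A).  A walk suffices:
-- any walk contains a path between its endpoints.
data Path {n} (D : Multigraph n) (A F : EdgeSet D) : Fin n → Fin n → Set where
  here : ∀ {u} → Path D A F u u
  step : ∀ {v} (e : Fin (m D)) → e ∈ A → e ∉ F →
         Path D A F (head D e) v → Path D A F (tail D e) v

StronglyConnectedMinus : ∀ {n} (D : Multigraph n) → EdgeSet D → Set
StronglyConnectedMinus D F = ∀ u v → Path D ⊤ F u v

StronglyKArcConnected : ∀ {n} → ℕ → Multigraph n → Set
StronglyKArcConnected k D =
  (F : EdgeSet D) → ∣ F ∣ ≤ k ∸ 1 → StronglyConnectedMinus D F

IsArcEscaper : ∀ {n} → ℕ → (D : Multigraph n) →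
               EdgeSet D → Subset n → Subset n → Set
IsArcEscaper {n} k D Eesc U Uout =
    (∀ (x : Fin n) → x ∈ Uout → x ∉ U)
  × ((F : EdgeSet D) → ∣ F ∣ ≤ k ∸ 1 → ∀ u → u ∈ U →
       ∃[ w ] (w ∈ Uout × Path D Eesc F u w))
  × ((F : EdgeSet D) → ∣ F ∣ ≤ k ∸ 1 → ∀ v → v ∈ U →
       ∃[ w ] (w ∈ Uout × Path D Eesc F w v))

module Submission where

-- Since U is a proper subset, strong k-arc-connectivity means that every nonempty X ⊆ U
-- is left by at least k edges of D. Lovász's proof of Edmonds' branching theorem splits
-- off from any such edge set H a set B of at most |U| edges that leaves every nonempty
-- X ⊆ U, while H ∖ B still leaves each of them k − 1 times: B is grown one edge at a time,
-- always taking an edge out of the not yet covered part of U that leaves no tight set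
-- (a nonempty X ⊆ U left by only k − 1 edges of H ∖ B); such an edge exists because tight
-- sets are closed under intersection, by submodularity of the out-degree.
-- Splitting off k times gives L with |L| ≤ k|U| leaving every nonempty X ⊆ U k times.
-- Then after deleting fewer than k edges, the part of U reachable from u in L is still left
-- by an edge of L, so u reaches a head of an L-edge outside U, and there are at most |L|
-- such heads. The same argument in the reverse of D gives the paths into U; the union of
-- the two halves has at most 2k|U| edges and 2k|U| out-vertices.

open import Defs
open import Data.Bool using (Bool; true; false; _∧_; _∨_; not)
import Data.Bool.Properties as Bool
open import Data.Empty using (⊥; ⊥-elim)
open import Data.Fin using (Fin; zero; suc; _≟_)
open import Data.Fin.Properties using (any?; all?)
open import Data.Fin.Subset using (Subset; _∈_; _∉_; ⊤; _⊂_; ∣_∣)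
open import Data.Fin.Subset.Properties using (anySubset?)
open import Data.Nat using (ℕ; zero; suc; _+_; _*_; _∸_; _≤_; _≰_; _<_; z≤n; s≤s; _≤?_)
open import Data.Nat.Properties hiding (_≟_)
open import Algebra.Properties.CommutativeMonoid.Sum +-0-commutativeMonoid
  using (sum; sum-syntax; ∑-distrib-+; ∑-comm; sum-cong-≗; sum-replicate-zero)
open import Data.Product using (_×_; _,_; proj₁; proj₂; ∃; ∃-syntax)
open import Data.Sum using (_⊎_; inj₁; inj₂; [_,_]′)
open import Data.Vec using (lookup; tabulate; []; _∷_)
open import Data.Vec.Properties using (lookup∘tabulate; []=⇒lookup; lookup⇒[]=)
open import Function using (_∘_)
open import Relation.Binary.PropositionalEquality
open import Relation.Nullary using (¬_; Dec; yes; no; does)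
open import Relation.Nullary.Decidable using (dec-true; dec-false; _×-dec_; _→-dec_)

-- Vertex and edge sets are handled as characteristic functions; the Vec-based Subsets
-- of the statement are converted with lookup and tabulate.
FinSet : ℕ → Set
FinSet n = Fin n → Bool

⟦_⟧ : Bool → ℕ
⟦ true ⟧  = 1
⟦ false ⟧ = 0

∧⁺ : ∀ {a b} → a ≡ true → b ≡ true → a ∧ b ≡ true
∧⁺ refl refl = refl

∧⁻ : ∀ {a b} → a ∧ b ≡ true → a ≡ true × b ≡ true
∧⁻ {true} {true} _ = refl , refl

∧-not⁺ : ∀ {a b} → a ≡ true → b ≡ false → a ∧ not b ≡ true
∧-not⁺ refl refl = refl

∧-not⁻ : ∀ {a b} → a ∧ not b ≡ true → a ≡ true × b ≡ false
∧-not⁻ {true} {false} _ = refl , refl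

∨⁺ˡ : ∀ {a b} → a ≡ true → a ∨ b ≡ true
∨⁺ˡ refl = refl

∨⁺ʳ : ∀ {a b} → b ≡ true → a ∨ b ≡ true
∨⁺ʳ {true}  _ = refl
∨⁺ʳ {false} p = p

∨⁻ : ∀ {a b} → a ∨ b ≡ true → a ≡ true ⊎ b ≡ true
∨⁻ {true}  _ = inj₁ refl
∨⁻ {false} p = inj₂ p

¬-false : ∀ {a} → ¬ (a ≡ false) → a ≡ true
¬-false {true}  _   = refl
¬-false {false} a≢f = ⊥-elim (a≢f refl)

¬-true : ∀ {a} → ¬ (a ≡ true) → a ≡ false
¬-true {true}  a≢t = ⊥-elim (a≢t refl)
¬-true {false} _   = refl

⟦⟧≤1 : ∀ b → ⟦ b ⟧ ≤ 1
⟦⟧≤1 true  = ≤-refl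
⟦⟧≤1 false = z≤n

⟦⟧-mono : ∀ {a b} → (a ≡ true → b ≡ true) → ⟦ a ⟧ ≤ ⟦ b ⟧
⟦⟧-mono {false} _   = z≤n
⟦⟧-mono {true}  a⇒b rewrite a⇒b refl = ≤-refl

⟦∧⟧+⟦∨⟧ : ∀ a b → ⟦ a ∧ b ⟧ + ⟦ a ∨ b ⟧ ≡ ⟦ a ⟧ + ⟦ b ⟧
⟦∧⟧+⟦∨⟧ true  true  = refl
⟦∧⟧+⟦∨⟧ true  false = refl
⟦∧⟧+⟦∨⟧ false b     = refl

⟦⟧-split : ∀ a b → ⟦ a ⟧ ≡ ⟦ a ∧ b ⟧ + ⟦ a ∧ not b ⟧
⟦⟧-split true  true  = refl
⟦⟧-split true  false = refl
⟦⟧-split false b     = refl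

⟦⟧-submodular : ∀ h a b c e →
  ⟦ h ∧ ((a ∧ b) ∧ not (c ∧ e)) ⟧ + ⟦ h ∧ ((a ∨ b) ∧ not (c ∨ e)) ⟧ ≤
  ⟦ h ∧ (a ∧ not c) ⟧ + ⟦ h ∧ (b ∧ not e) ⟧
⟦⟧-submodular false _     _     _     _     = z≤n
⟦⟧-submodular true  true  true  true  true  = z≤n
⟦⟧-submodular true  true  true  true  false = ≤-refl
⟦⟧-submodular true  true  true  false true  = ≤-refl
⟦⟧-submodular true  true  true  false false = ≤-refl
⟦⟧-submodular true  true  false true  _     = z≤n
⟦⟧-submodular true  true  false false e     = ⟦⟧≤1 (not e)
⟦⟧-submodular true  false true  true  _     = z≤n
⟦⟧-submodular true  false true  false _     = ≤-refl
⟦⟧-submodular true  false false _     _     = z≤n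

∧-not-∨ : ∀ a b c → a ∧ not (b ∨ c) ≡ (a ∧ not b) ∧ not c
∧-not-∨ true  true  c = refl
∧-not-∨ true  false c = refl
∧-not-∨ false b     c = refl

∧-swapʳ : ∀ a b c → (a ∧ b) ∧ c ≡ (a ∧ c) ∧ b
∧-swapʳ true  b c = Bool.∧-comm b c
∧-swapʳ false b c = refl

module _ {n : ℕ} where

  ∅ full : FinSet n
  ∅ _ = false
  full _ = true

  ⁅_⁆ : Fin n → FinSet n
  ⁅ x ⁆ i = does (i ≟ x)

  infixr 7 _∩_
  infixr 6 _∪_ _∖_
  infix 4 _⊆_

  _∩_ _∪_ _∖_ : FinSet n → FinSet n → FinSet n
  (X ∩ Y) i = X i ∧ Y i
  (X ∪ Y) i = X i ∨ Y i
  (X ∖ Y) i = X i ∧ not (Y i)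

  _⊆_ : FinSet n → FinSet n → Set
  X ⊆ Y = ∀ i → X i ≡ true → Y i ≡ true

  ∪-⊆ : ∀ {X Y Z} → X ⊆ Z → Y ⊆ Z → X ∪ Y ⊆ Z
  ∪-⊆ {X} X⊆Z Y⊆Z i p with X i in Xi
  ... | true  = X⊆Z i Xi
  ... | false = Y⊆Z i p

  Nonempty : FinSet n → Set
  Nonempty X = ∃[ i ] X i ≡ true

  count : FinSet n → ℕ
  count X = sum (λ i → ⟦ X i ⟧)

  ⁅⁆-self : ∀ x → ⁅ x ⁆ x ≡ true
  ⁅⁆-self x = dec-true (x ≟ x) refl

  ⁅⁆-other : ∀ {x i} → i ≢ x → ⁅ x ⁆ i ≡ false
  ⁅⁆-other {x} {i} = dec-false (i ≟ x)

  ⁅⁆⇒≡ : ∀ {x i} → ⁅ x ⁆ i ≡ true → i ≡ x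
  ⁅⁆⇒≡ {x} {i} p with i ≟ x
  ... | yes i≡x = i≡x

∸1<⇒≤ : ∀ k {d} → k ∸ 1 < d → k ≤ d
∸1<⇒≤ zero    _   = z≤n
∸1<⇒≤ (suc k) k<d = k<d

≤∸1⇒< : ∀ {k d} → 1 ≤ k → d ≤ k ∸ 1 → d < k
≤∸1⇒< {suc k} _ d≤k = s≤s d≤k

sum-mono-≤ : ∀ {m} {f g : Fin m → ℕ} → (∀ i → f i ≤ g i) → sum f ≤ sum g
sum-mono-≤ {zero}  f≤g = z≤n
sum-mono-≤ {suc m} f≤g = +-mono-≤ (f≤g zero) (sum-mono-≤ (f≤g ∘ suc))

sum-mono-< : ∀ {m} {f g : Fin m → ℕ} → (∀ i → f i ≤ g i) → ∀ j → f j < g j → sum f < sum g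
sum-mono-< f≤g zero    fj<gj = +-mono-<-≤ fj<gj (sum-mono-≤ (f≤g ∘ suc))
sum-mono-< f≤g (suc j) fj<gj = +-mono-≤-< (f≤g zero) (sum-mono-< (f≤g ∘ suc) j fj<gj)

module _ {n : ℕ} where

  count-cong : ∀ {X Y : FinSet n} → (∀ i → X i ≡ Y i) → count X ≡ count Y
  count-cong X≗Y = sum-cong-≗ (cong ⟦_⟧ ∘ X≗Y)

  count-mono : ∀ {X Y : FinSet n} → X ⊆ Y → count X ≤ count Y
  count-mono X⊆Y = sum-mono-≤ (λ i → ⟦⟧-mono (X⊆Y i))

  count-mono-< : ∀ {X Y : FinSet n} → X ⊆ Y → ∀ {i} → X i ≡ false → Y i ≡ true → count X < count Y
  count-mono-< X⊆Y {i} Xi Yi =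
    sum-mono-< (λ j → ⟦⟧-mono (X⊆Y j)) i (subst₂ (λ a b → ⟦ a ⟧ < ⟦ b ⟧) (sym Xi) (sym Yi) ≤-refl)

  count-∩-≤ʳ : ∀ (X Y : FinSet n) → count (X ∩ Y) ≤ count Y
  count-∩-≤ʳ X Y = count-mono (λ i p → proj₂ (∧⁻ p))

  count-∩-< : ∀ (X Y : FinSet n) {i} → X i ≡ true → Y i ≡ false → count (X ∩ Y) < count X
  count-∩-< X Y {i} Xi Yi = count-mono-< (λ j p → proj₁ (∧⁻ p)) (trans (cong (_∧ Y i) Xi) Yi) Xi

  count-∖-≤ : ∀ (X Y : FinSet n) → count (X ∖ Y) ≤ count X
  count-∖-≤ X Y = count-mono (λ i p → proj₁ (∧⁻ p))

  count-∩-∪ : ∀ (X Y : FinSet n) → count (X ∩ Y) + count (X ∪ Y) ≡ count X + count Y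
  count-∩-∪ X Y = begin
    count (X ∩ Y) + count (X ∪ Y)          ≡⟨ ∑-distrib-+ (λ i → ⟦ X i ∧ Y i ⟧) _ ⟨
    sum (λ i → ⟦ X i ∧ Y i ⟧ + ⟦ X i ∨ Y i ⟧) ≡⟨ sum-cong-≗ (λ i → ⟦∧⟧+⟦∨⟧ (X i) (Y i)) ⟩
    sum (λ i → ⟦ X i ⟧ + ⟦ Y i ⟧)           ≡⟨ ∑-distrib-+ (λ i → ⟦ X i ⟧) _ ⟩
    count X + count Y                       ∎
    where open ≡-Reasoning

  count-∩-∖ : ∀ (X Y : FinSet n) → count X ≡ count (X ∩ Y) + count (X ∖ Y)
  count-∩-∖ X Y = trans (sum-cong-≗ (λ i → ⟦⟧-split (X i) (Y i))) (∑-distrib-+ (λ i → ⟦ X i ∧ Y i ⟧) _)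

  count-∅ : count (∅ {n}) ≡ 0
  count-∅ = sum-replicate-zero n

  count-escape : ∀ (A F : FinSet n) → count F < count A → ∃[ i ] (A i ≡ true × F i ≡ false)
  count-escape A F F<A with any? (λ i → (A ∖ F) i Bool.≟ true)
  ... | yes (i , i∈A∖F) = i , ∧-not⁻ i∈A∖F
  ... | no  A∖F≡∅       = ⊥-elim (<⇒≱ F<A (count-mono A⊆F))
    where
    A⊆F : A ⊆ F
    A⊆F i Ai = ¬-false (λ Fi → A∖F≡∅ (i , ∧-not⁺ Ai Fi))

  ⁅⁆⊆ : ∀ {X : FinSet n} {x} → X x ≡ true → ⁅ x ⁆ ⊆ X
  ⁅⁆⊆ {X} Xx i p = subst (λ j → X j ≡ true) (sym (⁅⁆⇒≡ p)) Xx

  count-∪-≤ : ∀ (X Y : FinSet n) → count (X ∪ Y) ≤ count X + count Y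
  count-∪-≤ X Y = subst (count (X ∪ Y) ≤_) (count-∩-∪ X Y) (m≤n+m _ _)

  count-∪-disjoint : ∀ (X Y : FinSet n) → (∀ i → X i ≡ true → Y i ≡ false) →
                     count (X ∪ Y) ≡ count X + count Y
  count-∪-disjoint X Y disj = begin
    count (X ∪ Y)                 ≡⟨ cong (_+ count (X ∪ Y)) (trans (count-cong X∩Y≗∅) count-∅) ⟨
    count (X ∩ Y) + count (X ∪ Y) ≡⟨ count-∩-∪ X Y ⟩
    count X + count Y             ∎
    where
    open ≡-Reasoning
    X∩Y≗∅ : ∀ i → X i ∧ Y i ≡ false
    X∩Y≗∅ i with X i in Xi
    ... | false = refl
    ... | true  = disj i Xi

count-⁅⁆ : ∀ {n} (x : Fin n) → count ⁅ x ⁆ ≡ 1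
count-⁅⁆ {suc n} zero    = cong suc (count-∅ {n})
count-⁅⁆ {suc n} (suc x) = count-⁅⁆ x

count-≥1 : ∀ {n} {X : FinSet n} {x} → X x ≡ true → 1 ≤ count X
count-≥1 {X = X} {x} Xx = subst (_≤ count X) (count-⁅⁆ x) (count-mono (⁅⁆⊆ {X = X} Xx))

count-insert : ∀ {n} (X : FinSet n) {x} → X x ≡ false → count (X ∪ ⁅ x ⁆) ≡ suc (count X)
count-insert X {x} Xx = begin
  count (X ∪ ⁅ x ⁆)       ≡⟨ count-∪-disjoint X ⁅ x ⁆ (λ i Xi → ⁅⁆-other (λ i≡x → Bool.not-¬ Xi (x∉X i≡x))) ⟩
  count X + count ⁅ x ⁆   ≡⟨ cong (count X +_) (count-⁅⁆ x) ⟩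
  count X + 1             ≡⟨ +-comm (count X) 1 ⟩
  suc (count X)           ∎
  where
  open ≡-Reasoning
  x∉X : ∀ {i} → i ≡ x → X i ≡ false
  x∉X refl = Xx

count-remove : ∀ {n} (X : FinSet n) {x} → X x ≡ true → count X ≡ suc (count (X ∖ ⁅ x ⁆))
count-remove X {x} Xx = begin
  count X                                 ≡⟨ count-∩-∖ X ⁅ x ⁆ ⟩
  count (X ∩ ⁅ x ⁆) + count (X ∖ ⁅ x ⁆)   ≡⟨ cong (_+ count (X ∖ ⁅ x ⁆)) (count-cong X∩⁅x⁆≗⁅x⁆) ⟩
  count ⁅ x ⁆ + count (X ∖ ⁅ x ⁆)         ≡⟨ cong (_+ count (X ∖ ⁅ x ⁆)) (count-⁅⁆ x) ⟩
  suc (count (X ∖ ⁅ x ⁆))                 ∎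
  where
  open ≡-Reasoning
  X∩⁅x⁆≗⁅x⁆ : ∀ i → X i ∧ ⁅ x ⁆ i ≡ ⁅ x ⁆ i
  X∩⁅x⁆≗⁅x⁆ i with i ≟ x
  ... | yes refl rewrite Xx = refl
  ... | no  _    = Bool.∧-zeroʳ (X i)

count-full : ∀ n → count (full {n}) ≡ n
count-full zero    = refl
count-full (suc n) = cong suc (count-full n)

count-pos : ∀ {n} (X : FinSet n) → 0 < count X → Nonempty X
count-pos {suc n} X pos with X zero in X0
... | true  = zero , X0
... | false = let i , Xi = count-pos (X ∘ suc) pos in suc i , Xi

any-FinSet? : ∀ {n} {P : FinSet n → Set} → (∀ {X Y} → (∀ i → X i ≡ Y i) → P X → P Y) →
              (∀ X → Dec (P X)) → Dec (∃ P)
any-FinSet? P-cong P? with anySubset? (P? ∘ lookup)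
... | yes (S , PS) = yes (lookup S , PS)
... | no  none     = no (λ (X , PX) → none (tabulate X , P-cong (λ i → sym (lookup∘tabulate X i)) PX))

∣∣≡count : ∀ {n} (p : Subset n) → ∣ p ∣ ≡ count (lookup p)
∣∣≡count []          = refl
∣∣≡count (true ∷ p)  = cong suc (∣∣≡count p)
∣∣≡count (false ∷ p) = ∣∣≡count p

∣tabulate∣ : ∀ {n} (X : FinSet n) → ∣ tabulate X ∣ ≡ count X
∣tabulate∣ X = trans (∣∣≡count (tabulate X)) (count-cong (lookup∘tabulate X))

∈⇒true : ∀ {n} {p : Subset n} {x} → x ∈ p → lookup p x ≡ true
∈⇒true = []=⇒lookup

true⇒∈ : ∀ {n} {p : Subset n} {x} → lookup p x ≡ true → x ∈ p
true⇒∈ {p = p} {x} = lookup⇒[]= x p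

false⇒∉ : ∀ {n} {p : Subset n} {x} → lookup p x ≡ false → x ∉ p
false⇒∉ px≡false x∈p = Bool.not-¬ (∈⇒true x∈p) px≡false

∈tabulate⁺ : ∀ {n} {X : FinSet n} {x} → X x ≡ true → x ∈ tabulate X
∈tabulate⁺ {X = X} {x} Xx = true⇒∈ (trans (lookup∘tabulate X x) Xx)

∈tabulate⁻ : ∀ {n} {X : FinSet n} {x} → x ∈ tabulate X → X x ≡ true
∈tabulate⁻ {X = X} {x} x∈ = trans (sym (lookup∘tabulate X x)) (∈⇒true x∈)

∈tabulate-∪⁺ˡ : ∀ {n} {X Y : FinSet n} x → x ∈ tabulate X → x ∈ tabulate (X ∪ Y)
∈tabulate-∪⁺ˡ _ = ∈tabulate⁺ ∘ ∨⁺ˡ ∘ ∈tabulate⁻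

∈tabulate-∪⁺ʳ : ∀ {n} {X Y : FinSet n} x → x ∈ tabulate Y → x ∈ tabulate (X ∪ Y)
∈tabulate-∪⁺ʳ _ = ∈tabulate⁺ ∘ ∨⁺ʳ ∘ ∈tabulate⁻

module _ {n} {D : Multigraph n} where

  _++ᵖ_ : ∀ {A F : EdgeSet D} {u v w} → Path D A F u v → Path D A F v w → Path D A F u w
  here            ++ᵖ q = q
  step e e∈A e∉F p ++ᵖ q = step e e∈A e∉F (p ++ᵖ q)

  Path-mono : ∀ {A A′ F : EdgeSet D} {u v} → (∀ e → e ∈ A → e ∈ A′) → Path D A F u v → Path D A′ F u v
  Path-mono A⊆A′ here                = here
  Path-mono A⊆A′ (step e e∈A e∉F p) = step e (A⊆A′ e e∈A) e∉F (Path-mono A⊆A′ p)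

reverse : ∀ {n} → Multigraph n → Multigraph n
reverse D = record
  { m = m D ; tail = head D ; head = tail D ; loopless = λ e eq → loopless D e (sym eq) }

module _ {n} {D : Multigraph n} {A F : EdgeSet D} where

  Path-reverse : ∀ {u v} → Path D A F u v → Path (reverse D) A F v u
  Path-reverse here               = here
  Path-reverse (step e e∈A e∉F p) = Path-reverse p ++ᵖ step e e∈A e∉F here

  Path-unreverse : ∀ {u v} → Path (reverse D) A F u v → Path D A F v u
  Path-unreverse here               = here
  Path-unreverse (step e e∈A e∉F p) = Path-unreverse p ++ᵖ step e e∈A e∉F here

module Cuts {n} (D : Multigraph n) where

  leaving : FinSet n → FinSet (m D)
  leaving X e = X (tail D e) ∧ not (X (head D e))

  outDeg : FinSet (m D) → FinSet n → ℕ
  outDeg H X = count (H ∩ leaving X)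

  Path-leaves : ∀ {A F : EdgeSet D} {u v} (X : FinSet n) → Path D A F u v → X u ≡ true → X v ≡ false →
                ∃[ e ] (e ∉ F × leaving X e ≡ true)
  Path-leaves X here                Xu Xv = ⊥-elim (Bool.not-¬ Xu Xv)
  Path-leaves X (step e e∈A e∉F p) Xu Xv with X (head D e) in Xh
  ... | true  = Path-leaves X p Xh Xv
  ... | false = e , e∉F , ∧-not⁺ Xu Xh

  outDeg-cong : ∀ {H H′} → (∀ e → H e ≡ H′ e) → ∀ X → outDeg H X ≡ outDeg H′ X
  outDeg-cong H≗H′ X = count-cong (λ e → cong (_∧ leaving X e) (H≗H′ e))

  outDeg-mono : ∀ {H H′} → H ⊆ H′ → ∀ X → outDeg H X ≤ outDeg H′ X
  outDeg-mono H⊆H′ X = count-mono (λ e p → let He , le = ∧⁻ p in ∧⁺ (H⊆H′ e He) le)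

  outDeg-submodular : ∀ H X Y → outDeg H (X ∩ Y) + outDeg H (X ∪ Y) ≤ outDeg H X + outDeg H Y
  outDeg-submodular H X Y = begin
    outDeg H (X ∩ Y) + outDeg H (X ∪ Y)
      ≡⟨ ∑-distrib-+ (λ e → ⟦ (H ∩ leaving (X ∩ Y)) e ⟧) _ ⟨
    sum (λ e → ⟦ (H ∩ leaving (X ∩ Y)) e ⟧ + ⟦ (H ∩ leaving (X ∪ Y)) e ⟧)
      ≤⟨ sum-mono-≤ (λ e → ⟦⟧-submodular (H e) (X (tail D e)) (Y (tail D e)) (X (head D e)) (Y (head D e))) ⟩
    sum (λ e → ⟦ (H ∩ leaving X) e ⟧ + ⟦ (H ∩ leaving Y) e ⟧)
      ≡⟨ ∑-distrib-+ (λ e → ⟦ (H ∩ leaving X) e ⟧) _ ⟩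
    outDeg H X + outDeg H Y ∎
    where open ≤-Reasoning

  outDeg-∪-disjoint : ∀ {H H′} → (∀ e → H e ≡ true → H′ e ≡ false) →
                      ∀ X → outDeg (H ∪ H′) X ≡ outDeg H X + outDeg H′ X
  outDeg-∪-disjoint {H} {H′} disj X =
    trans (count-cong (λ e → Bool.∧-distribʳ-∨ (leaving X e) (H e) (H′ e)))
          (count-∪-disjoint (H ∩ leaving X) (H′ ∩ leaving X) disj′)
    where
    disj′ : ∀ e → H e ∧ leaving X e ≡ true → H′ e ∧ leaving X e ≡ false
    disj′ e p rewrite disj e (proj₁ (∧⁻ p)) = refl

  outDeg-remove-≤ : ∀ H X e → outDeg H X ≤ outDeg (H ∖ ⁅ e ⁆) X + 1
  outDeg-remove-≤ H X e = begin
    outDeg H X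
      ≡⟨ count-∩-∖ (H ∩ leaving X) ⁅ e ⁆ ⟩
    count ((H ∩ leaving X) ∩ ⁅ e ⁆) + count ((H ∩ leaving X) ∖ ⁅ e ⁆)
      ≤⟨ +-mono-≤ (count-∩-≤ʳ (H ∩ leaving X) ⁅ e ⁆) (≤-reflexive (count-cong (λ i → ∧-swapʳ (H i) _ _))) ⟩
    count ⁅ e ⁆ + outDeg (H ∖ ⁅ e ⁆) X
      ≡⟨ cong (_+ outDeg (H ∖ ⁅ e ⁆) X) (count-⁅⁆ e) ⟩
    1 + outDeg (H ∖ ⁅ e ⁆) X
      ≡⟨ +-comm 1 _ ⟩
    outDeg (H ∖ ⁅ e ⁆) X + 1 ∎
    where open ≤-Reasoning

  outDeg-remove-≡ : ∀ H X {e} → leaving X e ≡ false → outDeg (H ∖ ⁅ e ⁆) X ≡ outDeg H X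
  outDeg-remove-≡ H X {e} e∉lvX = count-cong same
    where
    same : ∀ i → (H i ∧ not (⁅ e ⁆ i)) ∧ leaving X i ≡ H i ∧ leaving X i
    same i with i ≟ e
    ... | yes refl rewrite e∉lvX = trans (Bool.∧-zeroʳ _) (sym (Bool.∧-zeroʳ (H i)))
    ... | no  i≢e  = cong (_∧ leaving X i) (Bool.∧-identityʳ (H i))

  leaving-cong : ∀ {X Y} → (∀ i → X i ≡ Y i) → ∀ e → leaving X e ≡ leaving Y e
  leaving-cong X≗Y e = cong₂ (λ a b → a ∧ not b) (X≗Y (tail D e)) (X≗Y (head D e))

module Escape {n} (D : Multigraph n) (U : FinSet n) where
  open Cuts D

  OutCut≥ : ℕ → FinSet (m D) → Set
  OutCut≥ j H = ∀ X → X ⊆ U → Nonempty X → j ≤ outDeg H X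

  Tight : ℕ → FinSet (m D) → FinSet n → Set
  Tight j R Y = Y ⊆ U × Nonempty Y × outDeg R Y ≤ j

  tight? : ∀ j R Y → Dec (Tight j R Y)
  tight? j R Y = all? (λ i → (Y i Bool.≟ true) →-dec (U i Bool.≟ true))
           ×-dec any? (λ i → Y i Bool.≟ true)
           ×-dec (outDeg R Y ≤? j)

  Tight-cong : ∀ {j R X Y} → (∀ i → X i ≡ Y i) → Tight j R X → Tight j R Y
  Tight-cong {j} {R} X≗Y (X⊆U , (x , Xx) , degX) =
    (λ i Yi → X⊆U i (trans (X≗Y i) Yi)) , (x , trans (sym (X≗Y x)) Xx) ,
    subst (_≤ j) (count-cong (λ e → cong (R e ∧_) (leaving-cong X≗Y e))) degX

  tight-∩ : ∀ {j R X Y} → OutCut≥ j R → Tight j R X → Tight j R Y → Nonempty (X ∩ Y) → Tight j R (X ∩ Y)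
  tight-∩ {j} {R} {X} {Y} cutR (X⊆U , (x , Xx) , degX) (Y⊆U , _ , degY) X∩Y≠∅ =
    (λ i p → X⊆U i (proj₁ (∧⁻ p))) , X∩Y≠∅ ,
    +-cancelʳ-≤ j _ j (begin
      outDeg R (X ∩ Y) + j                ≤⟨ +-monoʳ-≤ _ (cutR (X ∪ Y) (∪-⊆ X⊆U Y⊆U) (x , ∨⁺ˡ Xx)) ⟩
      outDeg R (X ∩ Y) + outDeg R (X ∪ Y) ≤⟨ outDeg-submodular R X Y ⟩
      outDeg R X + outDeg R Y             ≤⟨ +-mono-≤ degX degY ⟩
      j + j                               ∎)
    where
    open ≤-Reasoning

  module OneBranching (k : ℕ) (H : FinSet (m D)) (cutH : OutCut≥ (suc k) H) where

    record Invariant (W : FinSet n) (B : FinSet (m D)) : Set where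
      field
        W⊆U       : W ⊆ U
        B⊆H       : B ⊆ H
        B-tails   : ∀ e → B e ≡ true → W (tail D e) ≡ false
        B-reaches : ∀ X → X ⊆ U → (∃[ x ] (X x ≡ true × W x ≡ false)) → 1 ≤ outDeg B X
        rest-cut  : OutCut≥ k (H ∖ B)
        size      : count B + count W ≤ count U

    record GoodEdge (W : FinSet n) (B : FinSet (m D)) : Set where
      field
        edge     : Fin (m D)
        ∈H       : H edge ≡ true
        ∉B       : B edge ≡ false
        tail∈W   : W (tail D edge) ≡ true
        head∉W   : W (head D edge) ≡ false
        untight  : ∀ Y → Tight k (H ∖ B) Y → leaving Y edge ≡ false

    module _ {W B} (inv : Invariant W B) where
      open Invariant inv

      R : FinSet (m D)
      R = H ∖ B

      outDeg-inside : ∀ {X} → X ⊆ W → outDeg R X ≡ outDeg H X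
      outDeg-inside {X} X⊆W = count-cong same
        where
        same : ∀ e → (H e ∧ not (B e)) ∧ leaving X e ≡ H e ∧ leaving X e
        same e with B e in Be
        ... | false = cong (_∧ leaving X e) (Bool.∧-identityʳ (H e))
        ... | true with X (tail D e) in Xt
        ...   | false = trans (Bool.∧-zeroʳ _) (sym (Bool.∧-zeroʳ (H e)))
        ...   | true  = ⊥-elim (Bool.not-¬ (X⊆W _ Xt) (B-tails e Be))

      tight⊈W : ∀ {X} → Tight k R X → X ⊆ W → ⊥
      tight⊈W (X⊆U , X≠∅ , degX) X⊆W =
        <⇒≱ (s≤s degX) (subst (suc k ≤_) (sym (outDeg-inside X⊆W)) (cutH _ X⊆U X≠∅))

      R-leaves-W : Nonempty W → 0 < outDeg R W
      R-leaves-W W≠∅ = ≤-trans (s≤s z≤n) (subst (suc k ≤_) (sym (outDeg-inside (λ _ p → p))) (cutH W W⊆U W≠∅))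

      EdgeInto : FinSet n → Fin (m D) → Set
      EdgeInto X e = R e ≡ true × (X ∩ W) (tail D e) ≡ true × (X ∖ W) (head D e) ≡ true

      edgeInto? : ∀ X e → Dec (EdgeInto X e)
      edgeInto? X e = (R e Bool.≟ true) ×-dec ((X ∩ W) (tail D e) Bool.≟ true)
                        ×-dec ((X ∖ W) (head D e) Bool.≟ true)

      outDeg-∩W-≤ : ∀ X → (∀ e → ¬ EdgeInto X e) → outDeg R (X ∩ W) ≤ outDeg R X
      outDeg-∩W-≤ X none = count-mono R∩lv⊆
        where
        R∩lv⊆ : R ∩ leaving (X ∩ W) ⊆ R ∩ leaving X
        R∩lv⊆ e p with ∧⁻ p
        ... | Re , lv with ∧-not⁻ lv | X (head D e) in Xh
        ...   | XWt , _    | false = ∧⁺ Re (∧⁺ (proj₁ (∧⁻ XWt)) refl)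
        ...   | XWt , XWh  | true  =
                ⊥-elim (none e (Re , XWt , ∧-not⁺ Xh (trans (sym (cong (_∧ W (head D e)) Xh)) XWh)))

      tightLeaving? : ∀ e → Dec (∃[ Y ] (Tight k R Y × leaving Y e ≡ true))
      tightLeaving? e = any-FinSet?
        (λ Y≗ (tY , lY) → Tight-cong {R = R} Y≗ tY , trans (sym (leaving-cong Y≗ e)) lY)
        (λ Y → tight? k R Y ×-dec (leaving Y e Bool.≟ true))

      tightMeeting? : Dec (∃[ X ] (Tight k R X × Nonempty (X ∩ W)))
      tightMeeting? = any-FinSet?
        (λ X≗ (tX , x , XWx) → Tight-cong {R = R} X≗ tX , x , trans (cong (_∧ W x) (sym (X≗ x))) XWx)
        (λ X → tight? k R X ×-dec any? (λ x → (X ∩ W) x Bool.≟ true))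

      -- Descent to an inclusion-minimal tight set meeting W (c bounds |X|): an R-edge from X ∩ W
      -- into X ∖ W is good unless it leaves a tight Y, and then X ∩ Y is smaller; if there is no
      -- such edge, X ∩ W is a smaller tight set.
      good-edge-in : ∀ c X → count X < c → Tight k R X → ∀ {x} → X x ≡ true → W x ≡ true → GoodEdge W B
      good-edge-in (suc c) X X<c tX@(X⊆U , _ , degX) {x} Xx Wx with any? (edgeInto? X)
      ... | yes (e , Re , XWt , X∖Wh) with ∧-not⁻ Re | ∧⁻ XWt | ∧-not⁻ X∖Wh | tightLeaving? e
      ...   | He , Be | Xt , Wt | Xh , Wh | no none =
              record { edge = e ; ∈H = He ; ∉B = Be ; tail∈W = Wt ; head∉W = Wh
                     ; untight = λ Y tY → ¬-true (λ lY → none (Y , tY , lY)) }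
      ...   | _ | Xt , Wt | Xh , _ | yes (Y , tY , lY) with ∧-not⁻ lY
      ...     | Yt , Yh = good-edge-in c (X ∩ Y) (≤-trans (count-∩-< X Y Xh Yh) (≤-pred X<c))
                            (tight-∩ {R = R} rest-cut tX tY (tail D e , ∧⁺ Xt Yt)) (∧⁺ Xt Yt) Wt
      good-edge-in (suc c) X X<c tX@(X⊆U , _ , degX) {x} Xx Wx | no none
        with any? (λ y → (X ∖ W) y Bool.≟ true)
      ... | yes (y , X∖Wy) = let Xy , Wy = ∧-not⁻ X∖Wy in
              good-edge-in c (X ∩ W) (≤-trans (count-∩-< X W Xy Wy) (≤-pred X<c))
                ((λ i p → X⊆U i (proj₁ (∧⁻ p))) , (x , ∧⁺ Xx Wx) ,
                 ≤-trans (outDeg-∩W-≤ X (λ e → none ∘ (e ,_))) degX)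
                (∧⁺ Xx Wx) Wx
      ... | no X⊆W = ⊥-elim (tight⊈W tX (λ i Xi → ¬-false (λ Wi → X⊆W (i , ∧-not⁺ Xi Wi))))

      good-edge : Nonempty W → GoodEdge W B
      good-edge W≠∅ with tightMeeting?
      ... | yes (X , tX , x , XWx) = let Xx , Wx = ∧⁻ XWx in good-edge-in (suc (count X)) X ≤-refl tX Xx Wx
      ... | no none with count-pos (R ∩ leaving W) (R-leaves-W W≠∅)
      ...   | e , Re∧lv with ∧⁻ Re∧lv
      ...     | Re , lv with ∧-not⁻ Re | ∧-not⁻ lv
      ...       | He , Be | Wt , Wh = record
                  { edge = e ; ∈H = He ; ∉B = Be ; tail∈W = Wt ; head∉W = Wh
                  ; untight = λ Y tY → ¬-true (λ lY → none (Y , tY , tail D e , ∧⁺ (proj₁ (∧-not⁻ lY)) Wt)) }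

      module _ (g : GoodEdge W B) where
        open GoodEdge g

        private
          t : Fin n
          t = tail D edge

        ∪⁅edge⁆⊆H : B ∪ ⁅ edge ⁆ ⊆ H
        ∪⁅edge⁆⊆H e p with ∨⁻ p
        ... | inj₁ Be = B⊆H e Be
        ... | inj₂ e≡ = subst (λ i → H i ≡ true) (sym (⁅⁆⇒≡ e≡)) ∈H

        ∪⁅edge⁆-tails : ∀ e → (B ∪ ⁅ edge ⁆) e ≡ true → (W ∖ ⁅ t ⁆) (tail D e) ≡ false
        ∪⁅edge⁆-tails e p with ∨⁻ p
        ... | inj₁ Be = cong (_∧ not (⁅ t ⁆ (tail D e))) (B-tails e Be)
        ... | inj₂ e≡ = subst (λ i → (W ∖ ⁅ t ⁆) (tail D i) ≡ false) (sym (⁅⁆⇒≡ e≡))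
                          (trans (cong (λ b → W t ∧ not b) (⁅⁆-self t)) (Bool.∧-zeroʳ (W t)))

        ∪⁅edge⁆-reaches : ∀ X → X ⊆ U → (∃[ x ] (X x ≡ true × (W ∖ ⁅ t ⁆) x ≡ false)) →
                          1 ≤ outDeg (B ∪ ⁅ edge ⁆) X
        ∪⁅edge⁆-reaches X X⊆U (x , Xx , W′x) with any? (λ y → (X ∖ W) y Bool.≟ true)
        ... | yes (y , X∖Wy) =
              ≤-trans (B-reaches X X⊆U (y , ∧-not⁻ X∖Wy)) (outDeg-mono {B} {B ∪ ⁅ edge ⁆} (λ e → ∨⁺ˡ) X)
        ... | no  X⊄W = count-≥1 {X = (B ∪ ⁅ edge ⁆) ∩ leaving X} {edge}
                          (∧⁺ (∨⁺ʳ {B edge} (⁅⁆-self edge)) (∧-not⁺ Xt Xh))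
          where
          X⊆W : X ⊆ W
          X⊆W i Xi = ¬-false (λ Wi → X⊄W (i , ∧-not⁺ Xi Wi))
          x≡t : x ≡ t
          x≡t = ⁅⁆⇒≡ (¬-false (λ ⁅t⁆x → Bool.not-¬ (∧-not⁺ (X⊆W x Xx) ⁅t⁆x) W′x))
          Xt : X t ≡ true
          Xt = subst (λ i → X i ≡ true) x≡t Xx
          Xh : X (head D edge) ≡ false
          Xh = ¬-true (λ Xh → Bool.not-¬ (X⊆W _ Xh) head∉W)

        ∪⁅edge⁆-rest-cut : OutCut≥ k (H ∖ (B ∪ ⁅ edge ⁆))
        ∪⁅edge⁆-rest-cut X X⊆U X≠∅ with outDeg R X ≤? k
        ... | yes degX≤k = begin
              k                             ≤⟨ rest-cut X X⊆U X≠∅ ⟩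
              outDeg R X                    ≡⟨ outDeg-remove-≡ R X (untight X (X⊆U , X≠∅ , degX≤k)) ⟨
              outDeg (R ∖ ⁅ edge ⁆) X       ≡⟨ outDeg-cong (λ e → ∧-not-∨ (H e) (B e) _) X ⟨
              outDeg (H ∖ (B ∪ ⁅ edge ⁆)) X ∎
          where open ≤-Reasoning
        ... | no  degX≰k = +-cancelʳ-≤ 1 k _ (begin
              k + 1                             ≡⟨ +-comm k 1 ⟩
              suc k                             ≤⟨ ≰⇒> degX≰k ⟩
              outDeg R X                        ≤⟨ outDeg-remove-≤ R X edge ⟩
              outDeg (R ∖ ⁅ edge ⁆) X + 1       ≡⟨ cong (_+ 1) (outDeg-cong (λ e → ∧-not-∨ (H e) (B e) _) X) ⟨
              outDeg (H ∖ (B ∪ ⁅ edge ⁆)) X + 1 ∎)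
          where open ≤-Reasoning

        ∪⁅edge⁆-size : count (B ∪ ⁅ edge ⁆) + count (W ∖ ⁅ t ⁆) ≤ count U
        ∪⁅edge⁆-size = begin
          count (B ∪ ⁅ edge ⁆) + count (W ∖ ⁅ t ⁆)  ≡⟨ cong (_+ count (W ∖ ⁅ t ⁆)) (count-insert B ∉B) ⟩
          suc (count B) + count (W ∖ ⁅ t ⁆)        ≡⟨ +-suc (count B) _ ⟨
          count B + suc (count (W ∖ ⁅ t ⁆))        ≡⟨ cong (count B +_) (count-remove W tail∈W) ⟨
          count B + count W                        ≤⟨ size ⟩
          count U                                  ∎
          where open ≤-Reasoning

        add-good-edge : Invariant (W ∖ ⁅ t ⁆) (B ∪ ⁅ edge ⁆)
        add-good-edge = record
          { W⊆U       = λ i p → W⊆U i (proj₁ (∧⁻ p))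
          ; B⊆H       = ∪⁅edge⁆⊆H
          ; B-tails   = ∪⁅edge⁆-tails
          ; B-reaches = ∪⁅edge⁆-reaches
          ; rest-cut  = ∪⁅edge⁆-rest-cut
          ; size      = ∪⁅edge⁆-size
          }

    initial : Invariant U ∅
    initial = record
      { W⊆U       = λ _ Ui → Ui
      ; B⊆H       = λ _ ()
      ; B-tails   = λ _ ()
      ; B-reaches = λ X X⊆U (x , Xx , Ux) → ⊥-elim (Bool.not-¬ (X⊆U x Xx) Ux)
      ; rest-cut  = λ X X⊆U X≠∅ → ≤-trans (n≤1+n k)
                      (subst (suc k ≤_) (outDeg-cong (λ e → sym (Bool.∧-identityʳ (H e))) X) (cutH X X⊆U X≠∅))
      ; size      = ≤-reflexive (cong (_+ count U) (count-∅ {m D}))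
      }

    Branching : Set
    Branching = ∃[ B ] (B ⊆ H × count B ≤ count U × OutCut≥ 1 B × OutCut≥ k (H ∖ B))

    grow : ∀ c {W B} → count W ≡ c → Invariant W B → Branching
    grow zero {W} {B} |W|≡0 inv =
      B , B⊆H , ≤-trans (m≤m+n _ _) size , (λ X X⊆U (x , Xx) → B-reaches X X⊆U (x , Xx , W-empty x)) , rest-cut
      where
      open Invariant inv
      W-empty : ∀ x → W x ≡ false
      W-empty x = ¬-true (λ Wx → <⇒≱ (count-≥1 {X = W} Wx) (≤-reflexive |W|≡0))
    grow (suc c) {W} |W|≡1+c inv =
      grow c (suc-injective (trans (sym (count-remove W (GoodEdge.tail∈W g))) |W|≡1+c)) (add-good-edge inv g)
      where
      g : GoodEdge W _
      g = good-edge inv (count-pos W (subst (0 <_) (sym |W|≡1+c) (s≤s z≤n)))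

    branching : Branching
    branching = grow (count U) refl initial

  layers : ∀ j H → OutCut≥ j H → ∃[ L ] (L ⊆ H × count L ≤ j * count U × OutCut≥ j L)
  layers zero    H _    = ∅ , (λ _ ()) , ≤-reflexive (count-∅ {m D}) , (λ _ _ _ → z≤n)
  layers (suc j) H cutH with OneBranching.branching j H cutH
  ... | B , B⊆H , |B|≤|U| , cutB , cutH∖B with layers j (H ∖ B) cutH∖B
  ... | L , L⊆H∖B , |L|≤j|U| , cutL = B ∪ L , B∪L⊆H , |B∪L|≤ , cutB∪L
    where
    L∩B≡∅ : ∀ e → L e ≡ true → B e ≡ false
    L∩B≡∅ e Le = proj₂ (∧-not⁻ (L⊆H∖B e Le))
    B∪L⊆H : B ∪ L ⊆ H
    B∪L⊆H e p with ∨⁻ p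
    ... | inj₁ Be = B⊆H e Be
    ... | inj₂ Le = proj₁ (∧-not⁻ (L⊆H∖B e Le))
    |B∪L|≤ : count (B ∪ L) ≤ suc j * count U
    |B∪L|≤ = ≤-trans (count-∪-≤ B L) (+-mono-≤ |B|≤|U| |L|≤j|U|)
    cutB∪L : OutCut≥ (suc j) (B ∪ L)
    cutB∪L X X⊆U X≠∅ = subst (suc j ≤_)
      (sym (outDeg-∪-disjoint (λ e Be → ¬-true (λ Le → Bool.not-¬ Be (L∩B≡∅ e Le))) X))
      (+-mono-≤ (cutB X X⊆U X≠∅) (cutL X X⊆U X≠∅))

  cut-from-connectivity : ∀ k → StronglyKArcConnected k D → ∀ {y} → U y ≡ false → OutCut≥ k full
  cut-from-connectivity k conn {y} Uy X X⊆U (x , Xx) = ∸1<⇒≤ k (≰⇒> deg≰k-1)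
    where
    F : EdgeSet D
    F = tabulate (leaving X)
    Xy : X y ≡ false
    Xy = ¬-true (λ Xy → Bool.not-¬ (X⊆U y Xy) Uy)
    deg≰k-1 : outDeg full X ≰ k ∸ 1
    deg≰k-1 deg≤ with Path-leaves X (conn F (subst (_≤ k ∸ 1) (sym (∣tabulate∣ (leaving X))) deg≤) x y) Xx Xy
    ... | e , e∉F , lv = e∉F (∈tabulate⁺ lv)

  image : ∀ {m} → (Fin m → Fin n) → FinSet m → FinSet n
  image f A v = does (any? (λ e → (A e ∧ ⁅ f e ⁆ v) Bool.≟ true))

  image⁺ : ∀ {m} {f : Fin m → Fin n} {A} e → A e ≡ true → image f A (f e) ≡ true
  image⁺ {f = f} {A} e Ae = dec-true (any? _) (e , ∧⁺ Ae (⁅⁆-self (f e)))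

  count-image : ∀ {m} (f : Fin m → Fin n) A → count (image f A) ≤ count A
  count-image {m} f A = begin
    count (image f A)                          ≤⟨ sum-mono-≤ image≤fibre ⟩
    ∑[ v < n ] ∑[ e < m ] ⟦ A e ∧ ⁅ f e ⁆ v ⟧   ≡⟨ ∑-comm (λ v e → ⟦ A e ∧ ⁅ f e ⁆ v ⟧) ⟩
    ∑[ e < m ] ∑[ v < n ] ⟦ A e ∧ ⁅ f e ⁆ v ⟧   ≡⟨ sum-cong-≗ fibre-size ⟩
    count A                                    ∎
    where
    open ≤-Reasoning
    image≤fibre : ∀ v → ⟦ image f A v ⟧ ≤ ∑[ e < m ] ⟦ A e ∧ ⁅ f e ⁆ v ⟧
    image≤fibre v with any? (λ e → (A e ∧ ⁅ f e ⁆ v) Bool.≟ true)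
    ... | yes (e , p) = count-≥1 {X = λ e → A e ∧ ⁅ f e ⁆ v} p
    ... | no  _       = z≤n
    fibre-size : ∀ e → ∑[ v < n ] ⟦ A e ∧ ⁅ f e ⁆ v ⟧ ≡ ⟦ A e ⟧
    fibre-size e with A e
    ... | true  = count-⁅⁆ (f e)
    ... | false = count-∅ {n}

  out-vertices : FinSet (m D) → FinSet n
  out-vertices L = image (head D) L ∖ U

  count-out-vertices : ∀ L → count (out-vertices L) ≤ count L
  count-out-vertices L = ≤-trans (count-∖-≤ (image (head D) L) U) (count-image (head D) L)

  module _ {k} {L : FinSet (m D)} (cutL : OutCut≥ k L) {y} (Uy : U y ≡ false)
           {F : EdgeSet D} (|F|<k : ∣ F ∣ < k) {u : Fin n} where

    private
      PathsFrom-u : FinSet n → Set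
      PathsFrom-u X = ∀ x → X x ≡ true → Path D (tabulate L) F u x

    -- X ⊆ U consists of vertices reached from u; the fuel c bounds the remaining growth steps.
    escape-from : ∀ c X → n ≤ count X + c → X ⊆ U → Nonempty X → PathsFrom-u X →
                  ∃[ w ] (out-vertices L w ≡ true × Path D (tabulate L) F u w)
    escape-from zero X n≤|X| X⊆U _ _ = ⊥-elim (<⇒≱ |X|<n (subst (n ≤_) (+-identityʳ _) n≤|X|))
      where
      |X|<n : count X < n
      |X|<n = subst (count X <_) (count-full n)
                (count-mono-< {X = X} {Y = full} (λ _ _ → refl) (¬-true (λ Xy → Bool.not-¬ (X⊆U y Xy) Uy)) refl)
    escape-from (suc c) X n≤|X|+1+c X⊆U X≠∅ paths
      with count-escape (L ∩ leaving X) (lookup F)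
             (<-≤-trans (subst (_< k) (∣∣≡count F) |F|<k) (cutL X X⊆U X≠∅))
    ... | e , Le∧lv , Fe with ∧⁻ Le∧lv
    ...   | Le , lv = let Xt , Xh = ∧-not⁻ lv in
            extend (paths (tail D e) Xt ++ᵖ step e (∈tabulate⁺ Le) (false⇒∉ Fe) here) (image⁺ {f = head D} {L} e Le) Xh
      where
      extend : ∀ {v} → Path D (tabulate L) F u v → image (head D) L v ≡ true → X v ≡ false →
               ∃[ w ] (out-vertices L w ≡ true × Path D (tabulate L) F u w)
      extend {v} u⇝v v∈img Xv with U v in Uv
      ... | false = v , ∧-not⁺ v∈img Uv , u⇝v
      ... | true  =
            escape-from c (X ∪ ⁅ v ⁆) n≤ (∪-⊆ X⊆U (⁅⁆⊆ Uv)) (proj₁ X≠∅ , ∨⁺ˡ (proj₂ X≠∅)) paths′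
        where
        n≤ : n ≤ count (X ∪ ⁅ v ⁆) + c
        n≤ = subst (n ≤_) (trans (+-suc (count X) c) (cong (_+ c) (sym (count-insert X Xv)))) n≤|X|+1+c
        paths′ : PathsFrom-u (X ∪ ⁅ v ⁆)
        paths′ x p with ∨⁻ p
        ... | inj₁ Xx = paths x Xx
        ... | inj₂ q  = subst (Path D (tabulate L) F u) (sym (⁅⁆⇒≡ q)) u⇝v

  sparse-out-escape : ∀ k → 1 ≤ k → StronglyKArcConnected k D → ∀ {y} → U y ≡ false →
    ∃[ L ] (count L ≤ k * count U × count (out-vertices L) ≤ k * count U ×
      ((F : EdgeSet D) → ∣ F ∣ ≤ k ∸ 1 → ∀ {u} → U u ≡ true →
         ∃[ w ] (out-vertices L w ≡ true × Path D (tabulate L) F u w)))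
  sparse-out-escape k 1≤k conn Uy with layers k full (cut-from-connectivity k conn Uy)
  ... | L , _ , |L|≤k|U| , cutL =
    L , |L|≤k|U| , ≤-trans (count-out-vertices L) |L|≤k|U| ,
    λ F |F|≤k-1 {u} Uu → escape-from cutL Uy (≤∸1⇒< 1≤k |F|≤k-1) (suc n) ⁅ u ⁆
      (≤-trans (n≤1+n n) (m≤n+m (suc n) _)) (⁅⁆⊆ Uu) (u , ⁅⁆-self u)
      (λ x p → subst (Path D (tabulate L) F u) (sym (⁅⁆⇒≡ p)) here)

module _ {n} (k : ℕ) (D : Multigraph n) (U : Subset n) where

  EscapesOut EscapesIn : EdgeSet D → Subset n → Set
  EscapesOut E O = (F : EdgeSet D) → ∣ F ∣ ≤ k ∸ 1 → ∀ u → u ∈ U → ∃[ w ] (w ∈ O × Path D E F u w)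
  EscapesIn  E O = (F : EdgeSet D) → ∣ F ∣ ≤ k ∸ 1 → ∀ v → v ∈ U → ∃[ w ] (w ∈ O × Path D E F w v)

  EscapesOut-mono : ∀ {E E′ O O′} → (∀ e → e ∈ E → e ∈ E′) → (∀ w → w ∈ O → w ∈ O′) →
                    EscapesOut E O → EscapesOut E′ O′
  EscapesOut-mono E⊆E′ O⊆O′ esc F |F| u u∈U =
    let w , w∈O , u⇝w = esc F |F| u u∈U in w , O⊆O′ w w∈O , Path-mono E⊆E′ u⇝w

EscapesOut-reverse : ∀ {n} {k} {D : Multigraph n} {U E O} → EscapesOut k (reverse D) U E O → EscapesIn k D U E O
EscapesOut-reverse esc F |F| v v∈U = let w , w∈O , v⇝w = esc F |F| v v∈U in w , w∈O , Path-unreverse v⇝w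

reverse-connected : ∀ {n} {k} {D : Multigraph n} → StronglyKArcConnected k D → StronglyKArcConnected k (reverse D)
reverse-connected conn F |F| u v = Path-reverse (conn F |F| v u)

out-escaper : ∀ {n} k (D : Multigraph n) (U : Subset n) → 1 ≤ k → StronglyKArcConnected k D → ∀ {y} → y ∉ U →
  ∃[ E ] ∃[ O ] (count E ≤ k * ∣ U ∣ × count O ≤ k * ∣ U ∣ × (∀ x → O x ≡ true → x ∉ U) ×
                 EscapesOut k D U (tabulate E) (tabulate O))
out-escaper k D U 1≤k conn y∉U rewrite ∣∣≡count U
  with Escape.sparse-out-escape D (lookup U) k 1≤k conn (¬-true (y∉U ∘ true⇒∈))
... | L , |L|≤ , |O|≤ , esc =
  L , out-vertices L , |L|≤ , |O|≤ ,
  (λ x Ox x∈U → Bool.not-¬ (∈⇒true x∈U) (proj₂ (∧-not⁻ Ox))) ,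
  λ F |F| u u∈U → let w , Ow , u⇝w = esc F |F| (∈⇒true u∈U) in w , ∈tabulate⁺ Ow , u⇝w
  where open Escape D (lookup U) using (out-vertices)

∣tabulate-∪∣≤ : ∀ {n b} (X Y : FinSet n) → count X ≤ b → count Y ≤ b → ∣ tabulate (X ∪ Y) ∣ ≤ 2 * b
∣tabulate-∪∣≤ {b = b} X Y |X|≤b |Y|≤b = begin
  ∣ tabulate (X ∪ Y) ∣  ≡⟨ ∣tabulate∣ (X ∪ Y) ⟩
  count (X ∪ Y)        ≤⟨ count-∪-≤ X Y ⟩
  count X + count Y    ≤⟨ +-mono-≤ |X|≤b (≤-trans |Y|≤b (m≤m+n b 0)) ⟩
  2 * b                ∎
  where open ≤-Reasoning

lemma5p9 : (k n : ℕ) → 1 ≤ k → 1 ≤ n →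
    (D : Multigraph n) → StronglyKArcConnected k D →
    (U : Subset n) → U ⊂ ⊤ →
    ∃[ Eesc ] ∃[ Uout ]
      (IsArcEscaper k D Eesc U Uout
        × ∣ Eesc ∣ ≤ 4 * k * ∣ U ∣
        × ∣ Uout ∣ ≤ 2 * k * ∣ U ∣)
lemma5p9 k n 1≤k _ D conn U (_ , y , _ , y∉U)
  with out-escaper k D U 1≤k conn y∉U | out-escaper k (reverse D) U 1≤k (reverse-connected {k = k} conn) y∉U
... | E₁ , O₁ , |E₁|≤ , |O₁|≤ , O₁∩U≡∅ , esc₁ | E₂ , O₂ , |E₂|≤ , |O₂|≤ , O₂∩U≡∅ , esc₂ =
  tabulate (E₁ ∪ E₂) , tabulate (O₁ ∪ O₂) ,
  ( (λ x x∈O → [ O₁∩U≡∅ x , O₂∩U≡∅ x ]′ (∨⁻ (∈tabulate⁻ x∈O)))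
  , EscapesOut-mono k D U ∈tabulate-∪⁺ˡ ∈tabulate-∪⁺ˡ esc₁
  , EscapesOut-reverse {k = k} (EscapesOut-mono k (reverse D) U ∈tabulate-∪⁺ʳ ∈tabulate-∪⁺ʳ esc₂) )
  , ≤-trans (∣tabulate-∪∣≤ E₁ E₂ |E₁|≤ |E₂|≤) 2k|U|≤4k|U|
  , subst (∣ tabulate (O₁ ∪ O₂) ∣ ≤_) (sym (*-assoc 2 k ∣ U ∣)) (∣tabulate-∪∣≤ O₁ O₂ |O₁|≤ |O₂|≤)
  where
  2k|U|≤4k|U| : 2 * (k * ∣ U ∣) ≤ 4 * k * ∣ U ∣
  2k|U|≤4k|U| = subst (_≤ 4 * k * ∣ U ∣) (*-assoc 2 k ∣ U ∣)
                  (*-monoˡ-≤ ∣ U ∣ (*-monoˡ-≤ k {2} {4} (s≤s (s≤s z≤n))))
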